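{- Let $\mathcal{L}$ be a finite lattice and $x\in\mathcal{L}$. If $(y\vee x)\wedge z=y\vee(x\wedge z)$ holds for every cover relation $y\lessdot z$ in $\mathcal{L}$, then $x$ is left modular, i.e. $(y\vee x)\wedge z=y\vee(x\wedge z)$ for all $y\le z$ in $\mathcal{L}$. -}

module Defs where

open import Level using (Level; _⊔_)
open import Data.Nat using (ℕ)
open import Data.Fin using (Fin)
open import Data.Product using (Σ; ∃; _×_)
open import Relation.Nullary using (¬_; Dec)
open import Relation.Binary.Lattice.Bundles using (Lattice)

module _ {c ℓ₁ ℓ₂ : Level} (L : Lattice c ℓ₁ ℓ₂) where
  open Lattice L

  -- L is finite: its carrier is enumerated (up to ≈) by some Fin n, and
  -- equality of elements is decidable (the standard constructive reading
  -- of "finite set"; classically automatic).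
  IsFinite : Set (c ⊔ ℓ₁)
  IsFinite = (Σ ℕ λ n → Σ (Fin n → Carrier) λ f → ∀ a → ∃ λ i → f i ≈ a)
           × (∀ a b → Dec (a ≈ b))

  _<ₗ_ : Carrier → Carrier → Set (ℓ₁ ⊔ ℓ₂)
  a <ₗ b = a ≤ b × ¬ (a ≈ b)

  _⋖_ : Carrier → Carrier → Set (c ⊔ ℓ₁ ⊔ ℓ₂)
  y ⋖ z = y <ₗ z × (∀ w → ¬ (y <ₗ w × w <ₗ z))

  ModAt : Carrier → Carrier → Carrier → Set ℓ₁
  ModAt x y z = ((y ∨ x) ∧ z) ≈ (y ∨ (x ∧ z))

  LeftModular : Carrier → Set (c ⊔ ℓ₁ ⊔ ℓ₂)
  LeftModular x = ∀ y z → y ≤ z → ModAt x y z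

-- If the modular law for x failed at some y ≤ z, the interval from
-- b = y ∨ (x ∧ z) up to a = (y ∨ x) ∧ z would be nontrivial, and by
-- finiteness b would be covered by some d ≤ a. But for any d ≤ a, the law
-- at b ⋖ d reads (b ∨ x) ∧ d ≈ b ∨ (x ∧ d), whose left side is at least d
-- (as d ≤ y ∨ x) and whose right side is b (as x ∧ d ≤ x ∧ z); so d ≤ b.
module Submission where

open import Defs
open import Level using (Level)
open import Data.List using (List; []; _∷_; foldl; tabulate)
open import Data.List.Membership.Propositional using (_∈_)
open import Data.List.Membership.Propositional.Properties using (∈-tabulate⁺)
open import Data.List.Relation.Unary.Any using (here; there)
open import Data.Product using (∃; _×_; _,_; proj₁)
open import Data.Sum using (_⊎_; inj₁; inj₂)
open import Relation.Binary.Definitions using (Decidable)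
open import Relation.Binary.Lattice.Bundles using (Lattice)
import Relation.Binary.PropositionalEquality as ≡
open import Relation.Nullary using (¬_; yes; no; contradiction)
import Relation.Binary.Construct.NonStrictToStrict as ToStrict
import Relation.Binary.Lattice.Properties.MeetSemilattice as MeetProperties
import Relation.Binary.Properties.Poset as PosetProperties
import Relation.Binary.Reasoning.PartialOrder as PosetReasoning

module _ {c ℓ₁ ℓ₂ : Level} (L : Lattice c ℓ₁ ℓ₂) where
  open Lattice L
  open PosetProperties poset using (<-respʳ-≈; <⇒≱)

  private
    infix 4 _<_ _⋖ₗ_
    _<_ : Carrier → Carrier → Set _
    _<_ = _<ₗ_ L
    _⋖ₗ_ : Carrier → Carrier → Set _
    _⋖ₗ_ = _⋖_ L

  modular-inequality : ∀ {x y z} → y ≤ z → y ∨ (x ∧ z) ≤ (y ∨ x) ∧ z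
  modular-inequality {x} {y} {z} y≤z = ∨-least
    (∧-greatest (x≤x∨y y x) y≤z)
    (∧-greatest (trans (x∧y≤x x z) (y≤x∨y y x)) (x∧y≤y x z))

  ¬modAt-within-gap : ∀ {x y z d} → y ∨ (x ∧ z) < d → d ≤ (y ∨ x) ∧ z →
                      ¬ ModAt L x (y ∨ (x ∧ z)) d
  ¬modAt-within-gap {x} {y} {z} {d} b<d d≤a modAt = <⇒≱ b<d (begin
    d                      ≤⟨ ∧-greatest d≤b∨x refl ⟩
    (b ∨ x) ∧ d            ≈⟨ modAt ⟩
    b ∨ (x ∧ d)            ≤⟨ ∨-least refl x∧d≤b ⟩
    b                      ∎)
    where
    open PosetReasoning poset
    b = y ∨ (x ∧ z)
    d≤b∨x : d ≤ b ∨ x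
    d≤b∨x = trans d≤a (trans (x∧y≤x (y ∨ x) z)
              (∨-least (trans (x≤x∨y y (x ∧ z)) (x≤x∨y b x)) (y≤x∨y b x)))
    x∧d≤b : x ∧ d ≤ b
    x∧d≤b = trans (∧-greatest (x∧y≤x x d) (trans (x∧y≤y x d) (trans d≤a (x∧y≤y (y ∨ x) z))))
                  (y≤x∨y y (x ∧ z))

  module _ (_≟_ : Decidable _≈_) (b : Carrier) where
    private
      _≤?_ : Decidable _≤_
      _≤?_ = MeetProperties.≈-dec⇒≤-dec meetSemilattice _≟_
      _<?_ : Decidable _<_
      _<?_ = ToStrict.<-decidable _≈_ _≤_ _≟_ _≤?_

    -- Folding lowerAbove over an enumeration moves down to every element met
    -- that is strictly above b, so the result is minimal among those elements.
    lowerAbove : Carrier → Carrier → Carrier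
    lowerAbove c w with b <? w | w ≤? c
    ... | yes _ | yes _ = w
    ... | _     | _     = c

    lowerAbove-≤ : ∀ c w → lowerAbove c w ≤ c
    lowerAbove-≤ c w with b <? w | w ≤? c
    ... | yes _ | yes w≤c = w≤c
    ... | yes _ | no  _   = refl
    ... | no  _ | _       = refl

    lowerAbove-> : ∀ {c} w → b < c → b < lowerAbove c w
    lowerAbove-> {c} w b<c with b <? w | w ≤? c
    ... | yes b<w | yes _ = b<w
    ... | yes _   | no  _ = b<c
    ... | no  _   | _     = b<c

    lowerAbove-≤-target : ∀ {c w} → b < w → w ≤ c → lowerAbove c w ≤ w
    lowerAbove-≤-target {c} {w} b<w w≤c with b <? w | w ≤? c
    ... | yes _ | yes _   = refl
    ... | yes _ | no  w≰c = contradiction w≤c w≰c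
    ... | no  b≮w | _     = contradiction b<w b≮w

    descend : Carrier → List Carrier → Carrier
    descend = foldl lowerAbove

    descend-≤ : ∀ c ws → descend c ws ≤ c
    descend-≤ c []       = refl
    descend-≤ c (w ∷ ws) = trans (descend-≤ (lowerAbove c w) ws) (lowerAbove-≤ c w)

    descend-> : ∀ {c} ws → b < c → b < descend c ws
    descend-> []       b<c = b<c
    descend-> (w ∷ ws) b<c = descend-> ws (lowerAbove-> w b<c)

    descend-minimal : ∀ {c w} ws → b < c → w ∈ ws → b < w →
                      w ≤ descend c ws → descend c ws ≤ w
    descend-minimal {c} (w ∷ ws) b<c (here ≡.refl) b<w w≤d = trans d≤c′ c′≤w
      where
      c′ = lowerAbove c w
      d≤c′ = descend-≤ c′ ws
      c′≤w = lowerAbove-≤-target b<w (trans w≤d (trans d≤c′ (lowerAbove-≤ c w)))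
    descend-minimal (v ∷ ws) b<c (there w∈ws) =
      descend-minimal ws (lowerAbove-> v b<c) w∈ws

  cover-below : IsFinite L → ∀ {b a} → b < a → ∃ λ d → b ⋖ₗ d × d ≤ a
  cover-below ((_ , enum , surjective) , _≟_) {b} {a} b<a =
    d , (descend-> _≟_ b elements b<a , nothing-between) , descend-≤ _≟_ b a elements
    where
    elements : List Carrier
    elements = tabulate enum
    d : Carrier
    d = descend _≟_ b a elements
    nothing-between : ∀ w → ¬ (b < w × w < d)
    nothing-between w (b<w , w<d) with surjective w
    ... | i , eᵢ≈w = <⇒≱ w<d (begin
      d       ≤⟨ descend-minimal _≟_ b elements b<a (∈-tabulate⁺ i) b<eᵢ eᵢ≤d ⟩
      enum i  ≈⟨ eᵢ≈w ⟩
      w       ∎)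
      where
      open PosetReasoning poset
      b<eᵢ : b < enum i
      b<eᵢ = <-respʳ-≈ (Eq.sym eᵢ≈w) b<w
      eᵢ≤d : enum i ≤ d
      eᵢ≤d = trans (reflexive eᵢ≈w) (proj₁ w<d)

  ≈-or-covered-below : IsFinite L → ∀ {b a} → b ≤ a → b ≈ a ⊎ ∃ λ d → b ⋖ₗ d × d ≤ a
  ≈-or-covered-below finite@(_ , _≟_) {b} {a} b≤a with b ≟ a
  ... | yes b≈a = inj₁ b≈a
  ... | no  b≉a = inj₂ (cover-below finite (b≤a , b≉a))

lemma2p13 : {c ℓ₁ ℓ₂ : Level} (L : Lattice c ℓ₁ ℓ₂) → IsFinite L → (x : Lattice.Carrier L) → (∀ y z → _⋖_ L y z → ModAt L x y z) → LeftModular L x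
lemma2p13 L finite x modAt-at-covers y z y≤z
  with ≈-or-covered-below L finite (modular-inequality L y≤z)
... | inj₁ b≈a = Lattice.Eq.sym L b≈a
... | inj₂ (d , b⋖d , d≤a) =
  contradiction (modAt-at-covers _ d b⋖d) (¬modAt-within-gap L (proj₁ b⋖d) d≤a)
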